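{- Let $\alpha>1$ be irrational with continued fraction $\alpha=[a_0,a_1,\ldots]$ and convergent numerators $p_n$, and let $n\ge0$. Then $2p_n\in S_\alpha$ if and only if $p_n$ is odd and at least one of the following holds: (i) $p_{n+1}$ is odd and $a_{n+1}\ge3$; (ii) $p_{n+1}$ is even and $a_{n+1}\ge2$; (iii) $p_n=1$.
   Context: Continued fraction numerators: $p_{ -2}=0$, $p_{ -1}=1$, $p_{n+1}=a_{n+1}p_n+p_{n-1}$ for $n\ge-1$. For a positive integer $m$, $E(m)=m-q\alpha$ where $q\alpha$ is the integer multiple of $\alpha$ nearest to $m$. $A_\alpha=\{m\in\mathbb N:E(m)<0\}$, $B_\alpha=\{m\in\mathbb N:E(m)>0\}$, and $S_\alpha$ is the set of positive integers not expressible as $y_1+y_2$ with $y_1\ne y_2$ lying both in $A_\alpha$ or both in $B_\alpha$. -}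

module Defs where

open import Data.Nat using (ℕ; zero; suc; _+_; _*_; _≤_)
open import Data.Nat.Divisibility using (_∣_)
open import Data.Integer as ℤ using (ℤ; +_; -_; _-_)
open import Data.Product using (Σ; _×_; ∃; ∃-syntax)
open import Data.Sum using (_⊎_)
open import Relation.Nullary using (¬_)
open import Relation.Binary.PropositionalEquality using (_≡_; _≢_)

-- An irrational α > 1 is represented by its (infinite) continued fraction
-- α = [a 0, a 1, a 2, ...]; the partial quotients are positive integers
-- (a 0 ≥ 1 because α > 1).
CF : Set
CF = ℕ → ℕ

ValidCF : CF → Set
ValidCF a = ∀ i → 1 ≤ a i

-- Shifted numerators/denominators: P a k = p_{k-2}, Q a k = q_{k-2}.
-- p_{-2} = 0, p_{-1} = 1, p_{n} = a_n p_{n-1} + p_{n-2};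
-- q_{-2} = 1, q_{-1} = 0, q_{n} = a_n q_{n-1} + q_{n-2}.
P : CF → ℕ → ℕ
P a zero = 0
P a (suc zero) = 1
P a (suc (suc k)) = a k * P a (suc k) + P a k

Q : CF → ℕ → ℕ
Q a zero = 1
Q a (suc zero) = 0
Q a (suc (suc k)) = a k * Q a (suc k) + Q a k

p : CF → ℕ → ℕ
p a n = P a (suc (suc n))

q : CF → ℕ → ℕ
q a n = Q a (suc (suc n))

-- The real number x + y·α (x y : ℤ) is > 0.  Since α is irrational it lies
-- strictly between any two consecutive convergents p_k/q_k, p_{k+1}/q_{k+1},
-- and these converge to α; hence x + yα > 0 iff for some k the affine
-- function t ↦ x + y t is positive at both p_k/q_k and p_{k+1}/q_{k+1}.
PosLin : CF → ℤ → ℤ → Set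
PosLin a x y = ∃[ k ] ((+ 0 ℤ.< x ℤ.* + q a k ℤ.+ y ℤ.* + p a k)
                    × (+ 0 ℤ.< x ℤ.* + q a (suc k) ℤ.+ y ℤ.* + p a (suc k)))

-- |x₁ + y₁α| < |x₂ + y₂α|
AbsLt : CF → ℤ → ℤ → ℤ → ℤ → Set
AbsLt a x₁ y₁ x₂ y₂ =
  (PosLin a (x₂ - x₁) (y₂ - y₁) × PosLin a (x₂ ℤ.+ x₁) (y₂ ℤ.+ y₁))
  ⊎ (PosLin a (x₁ - x₂) (y₁ - y₂) × PosLin a (- x₁ - x₂) (- y₁ - y₂))

Nearest : CF → ℕ → ℤ → Set
Nearest a m t = ∀ (t' : ℤ) → t' ≢ t → AbsLt a (+ m) (- t) (+ m) (- t')

-- A_α : positive m with E(m) = m - tα < 0 (tα nearest multiple)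
InA : CF → ℕ → Set
InA a m = 1 ≤ m × ∃[ t ] (Nearest a m t × PosLin a (- (+ m)) t)

-- B_α : positive m with E(m) > 0
InB : CF → ℕ → Set
InB a m = 1 ≤ m × ∃[ t ] (Nearest a m t × PosLin a (+ m) (- t))

InS : CF → ℕ → Set
InS a n = 1 ≤ n × ¬ (∃[ y₁ ] ∃[ y₂ ] (1 ≤ y₁ × 1 ≤ y₂ × y₁ ≢ y₂ × y₁ + y₂ ≡ n
                      × ((InA a y₁ × InA a y₂) ⊎ (InB a y₁ × InB a y₂))))

Odd : ℕ → Set
Odd n = ¬ (2 ∣ n)

Even : ℕ → Set
Even n = 2 ∣ n

module Submission where

-- Let ζ = [a_{n+2}; a_{n+3}, …] be the complete quotient, so that x + yα has the sign of
-- X + Yζ with X = x q_n + y p_n and Y = x q_{n+1} + y p_{n+1}.  This change of coordinates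
-- has determinant ±1, and it turns m ∈ B (resp. A) into a lattice point (X, Y) with
-- 0 < X + Yζ < (p_n + p_{n+1} ζ)/2 and height X p_{n+1} - Y p_n = ±m, the sign depending
-- only on the parity of n and on the set.  Two such points with heights summing to ±2p_n add
-- up to (p_n, p_{n+1} - 2) or to (0, 2), the multiple of α being forced by the window.
-- The second case makes both points equal to (0, 1).  In the first case, if p_n is odd, one
-- of the points has 2X > p_n, and then its height is at least 2p_n as soon as
-- p_{n+1} ≥ 3p_n, or p_{n+1} ≥ 2p_n with p_{n+1} even.  Conversely, when p_n is even or this
-- gap condition fails, explicit window points give two distinct summands in the same set.
-- Finally p_{n+1} = a_{n+1} p_n + p_{n-1} with p_{n-1} < p_n (unless p_n = 1) translates the
-- gap condition into the condition on a_{n+1}.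

open import Defs
open import Data.Nat as ℕ using (ℕ; zero; suc; z≤n; s≤s)
import Data.Nat.Properties as ℕ
open import Data.Nat.Divisibility using (divides; _∣?_)
open import Data.Integer using (ℤ)
open import Data.List using (_∷_; [])
open import Data.Product using (_×_; _,_; proj₁; ∃-syntax)
open import Data.Sum using (_⊎_; inj₁; inj₂; [_,_]′)
open import Data.Empty using (⊥; ⊥-elim)
open import Function.Base using (id; _∘_; case_of_)
open import Function.Bundles using (_⇔_; mk⇔; Equivalence)
import Function.Properties.Equivalence as ⇔
open import Relation.Binary.PropositionalEquality
open import Relation.Binary.Definitions using (tri<; tri≈; tri>)
open import Relation.Nullary using (¬_; Dec; yes; no)

module Arithmetic where

  open import Data.Integer
    using (+_; -[1+_]; 0ℤ; 1ℤ; -1ℤ; _+_; _-_; -_; _*_; _≤_; _<_; +≤+; +<+; -≤-; -≤+; nonNegative)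
  open import Data.Integer.Properties
  open import Data.Integer.Tactic.RingSolver using (solve)

  pos-*-+ : ∀ m n l → + (m ℕ.* n ℕ.+ l) ≡ + m * + n + + l
  pos-*-+ m n l = trans (pos-+ (m ℕ.* n) l) (cong (_+ + l) (pos-* m n))

  i<j⇒0<j-i : ∀ {i j} → i < j → 0ℤ < j - i
  i<j⇒0<j-i {i} {j} i<j = subst (_< j - i) (+-inverseʳ i) (+-monoˡ-< (- i) i<j)

  0<j-i⇒i<j : ∀ {i j} → 0ℤ < j - i → i < j
  0<j-i⇒i<j {i} {j} 0<j-i = begin-strict
    i            ≡⟨ +-identityʳ i ⟨
    i + 0ℤ       <⟨ +-monoʳ-< i 0<j-i ⟩
    i + (j - i)  ≡⟨ solve (i ∷ j ∷ []) ⟩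
    j            ∎
    where open ≤-Reasoning

  1≤j⇒i≤j*i : ∀ {i j} → 1ℤ ≤ j → 0ℤ ≤ i → i ≤ j * i
  1≤j⇒i≤j*i {i} {j} 1≤j 0≤i = subst (_≤ j * i) (*-identityˡ i) (*-monoʳ-≤-nonNeg i {{nonNegative 0≤i}} 1≤j)

  j≤-1⇒j*i≤-i : ∀ {i j} → j ≤ -1ℤ → 0ℤ ≤ i → j * i ≤ - i
  j≤-1⇒j*i≤-i {i} {j} j≤-1 0≤i = subst (j * i ≤_) (-1*i≡-i i) (*-monoʳ-≤-nonNeg i {{nonNegative 0≤i}} j≤-1)

  i+i≤j+j⇒i≤j : ∀ {i j} → i + i ≤ j + j → i ≤ j
  i+i≤j+j⇒i≤j i+i≤j+j = ≮⇒≥ λ j<i → <⇒≱ (+-mono-< j<i j<i) i+i≤j+j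

  0<i+i⇒0<i : ∀ {i} → 0ℤ < i + i → 0ℤ < i
  0<i+i⇒0<i 0<i+i = ≰⇒> λ i≤0 → <⇒≱ 0<i+i (+-mono-≤ i≤0 i≤0)

  0<i+i-1⇒0<i : ∀ {i} → 0ℤ < i + i - 1ℤ → 0ℤ < i
  0<i+i-1⇒0<i 0<i+i-1 =
    ≰⇒> λ i≤0 → <⇒≱ 0<i+i-1 (≤-trans (+-monoˡ-≤ -1ℤ (+-mono-≤ i≤0 i≤0)) (-≤+ {0} {0}))

  0<i+i+1⇒0≤i : ∀ {i} → 0ℤ < i + i + 1ℤ → 0ℤ ≤ i
  0<i+i+1⇒0≤i { + n } _ = +≤+ z≤n
  0<i+i+1⇒0≤i { -[1+ n ] } 0<i+i+1 =
    ⊥-elim (<⇒≱ 0<i+i+1 (≤-trans (+-monoˡ-≤ 1ℤ (+-mono-≤ i≤-1 i≤-1)) (-≤+ {0} {0})))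
    where
    i≤-1 : -[1+ n ] ≤ -1ℤ
    i≤-1 = -≤- z≤n

  squeeze-≤ : ∀ {a b m} → a ≤ m → b ≤ m → a + b ≡ m + m → a ≡ m
  squeeze-≤ a≤m b≤m a+b≡m+m = ≤-antisym a≤m (≮⇒≥ λ a<m → <-irrefl a+b≡m+m (+-mono-<-≤ a<m b≤m))

  squeeze-≥ : ∀ {a b m} → m ≤ a → m ≤ b → a + b ≡ m + m → a ≡ m
  squeeze-≥ m≤a m≤b a+b≡m+m =
    ≤-antisym (≮⇒≥ λ m<a → <-irrefl (sym a+b≡m+m) (+-mono-<-≤ m<a m≤b)) m≤a

  i+1≢i : ∀ i → i + 1ℤ ≢ i
  i+1≢i i eq = <-irrefl (sym eq) (subst (_< i + 1ℤ) (+-identityʳ i) (+-monoʳ-< i (+<+ (s≤s z≤n))))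

  i+i≢1 : ∀ i → i + i ≢ 1ℤ
  i+i≢1 (+ zero) ()
  i+i≢1 (+ suc n) eq = ℕ.m+1+n≢0 n (ℕ.suc-injective (+-injective eq))
  i+i≢1 -[1+ n ] ()

  i+i≢j+j+1 : ∀ i j → i + i ≢ j + j + 1ℤ
  i+i≢j+j+1 i j eq = i+i≢1 (i - j) (begin
    (i - j) + (i - j)       ≡⟨ solve (i ∷ j ∷ []) ⟩
    (i + i) - (j + j)       ≡⟨ cong (_- (j + j)) eq ⟩
    (j + j + 1ℤ) - (j + j)  ≡⟨ solve (j ∷ []) ⟩
    1ℤ                      ∎)
    where open ≡-Reasoning

  Coprime : ℤ → ℤ → Set
  Coprime P₀ P₁ = ∃[ U ] ∃[ V ] (U * P₁ - V * P₀ ≡ 1ℤ)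

  ¬Coprime-evens : ∀ H K → ¬ Coprime (H + H) (K + K)
  ¬Coprime-evens H K (U , V , bezout) = i+i≢1 (U * K - V * H) (begin
    (U * K - V * H) + (U * K - V * H)  ≡⟨ solve (U ∷ K ∷ V ∷ H ∷ []) ⟩
    U * (K + K) - V * (H + H)          ≡⟨ bezout ⟩
    1ℤ                                 ∎)
    where open ≡-Reasoning

  coprime⇒proportional : ∀ {P₀ P₁} S₀ S₁ → Coprime P₀ P₁ → S₀ * P₁ ≡ S₁ * P₀ →
                         ∃[ c ] (S₀ ≡ c * P₀ × S₁ ≡ c * P₁)
  coprime⇒proportional {P₀} {P₁} S₀ S₁ (U , V , bezout) S₀P₁≡S₁P₀ =
    U * S₁ - V * S₀ , rescale S₀ P₀ S₀-scaled , rescale S₁ P₁ S₁-scaled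
    where
    open ≡-Reasoning
    rescale : ∀ S P → S * (U * P₁ - V * P₀) ≡ (U * S₁ - V * S₀) * P → S ≡ (U * S₁ - V * S₀) * P
    rescale S P eq = trans (sym (trans (cong (S *_) bezout) (*-identityʳ S))) eq
    S₀-scaled : S₀ * (U * P₁ - V * P₀) ≡ (U * S₁ - V * S₀) * P₀
    S₀-scaled = begin
      S₀ * (U * P₁ - V * P₀)       ≡⟨ solve (S₀ ∷ U ∷ P₁ ∷ V ∷ P₀ ∷ []) ⟩
      U * (S₀ * P₁) - V * S₀ * P₀  ≡⟨ cong (λ t → U * t - V * S₀ * P₀) S₀P₁≡S₁P₀ ⟩
      U * (S₁ * P₀) - V * S₀ * P₀  ≡⟨ solve (U ∷ S₁ ∷ P₀ ∷ V ∷ S₀ ∷ []) ⟩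
      (U * S₁ - V * S₀) * P₀       ∎
    S₁-scaled : S₁ * (U * P₁ - V * P₀) ≡ (U * S₁ - V * S₀) * P₁
    S₁-scaled = begin
      S₁ * (U * P₁ - V * P₀)       ≡⟨ solve (S₁ ∷ U ∷ P₁ ∷ V ∷ P₀ ∷ []) ⟩
      U * S₁ * P₁ - V * (S₁ * P₀)  ≡⟨ cong (λ t → U * S₁ * P₁ - V * t) S₀P₁≡S₁P₀ ⟨
      U * S₁ * P₁ - V * (S₀ * P₁)  ≡⟨ solve (U ∷ S₁ ∷ P₁ ∷ V ∷ S₀ ∷ []) ⟩
      (U * S₁ - V * S₀) * P₁       ∎

  unimodular-inverse : ∀ {P₀ P₁ Q₀ Q₁ D} x X Y → P₁ * Q₀ - P₀ * Q₁ ≡ D → D * D ≡ 1ℤ →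
                       X * P₁ - Y * P₀ ≡ D * x →
                       x * Q₀ + D * (Q₀ * Y - Q₁ * X) * P₀ ≡ X × x * Q₁ + D * (Q₀ * Y - Q₁ * X) * P₁ ≡ Y
  unimodular-inverse {P₀} {P₁} {Q₀} {Q₁} {D} x X Y det D²≡1 height = recover₀ , recover₁
    where
    open ≡-Reasoning
    x≡ : x ≡ D * (X * P₁ - Y * P₀)
    x≡ = begin
      x                      ≡⟨ *-identityˡ x ⟨
      1ℤ * x                 ≡⟨ cong (_* x) D²≡1 ⟨
      D * D * x              ≡⟨ *-assoc D D x ⟩
      D * (D * x)            ≡⟨ cong (D *_) height ⟨
      D * (X * P₁ - Y * P₀)  ∎
    undo : ∀ Z → D * (Z * (P₁ * Q₀ - P₀ * Q₁)) ≡ Z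
    undo Z = begin
      D * (Z * (P₁ * Q₀ - P₀ * Q₁))  ≡⟨ cong (λ d → D * (Z * d)) det ⟩
      D * (Z * D)                    ≡⟨ solve (D ∷ Z ∷ []) ⟩
      D * D * Z                      ≡⟨ cong (_* Z) D²≡1 ⟩
      1ℤ * Z                         ≡⟨ *-identityˡ Z ⟩
      Z                              ∎
    recover₀ : x * Q₀ + D * (Q₀ * Y - Q₁ * X) * P₀ ≡ X
    recover₀ = begin
      x * Q₀ + D * (Q₀ * Y - Q₁ * X) * P₀
        ≡⟨ cong (λ z → z * Q₀ + D * (Q₀ * Y - Q₁ * X) * P₀) x≡ ⟩
      D * (X * P₁ - Y * P₀) * Q₀ + D * (Q₀ * Y - Q₁ * X) * P₀
        ≡⟨ solve (D ∷ X ∷ Y ∷ P₀ ∷ P₁ ∷ Q₀ ∷ Q₁ ∷ []) ⟩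
      D * (X * (P₁ * Q₀ - P₀ * Q₁))
        ≡⟨ undo X ⟩
      X ∎
    recover₁ : x * Q₁ + D * (Q₀ * Y - Q₁ * X) * P₁ ≡ Y
    recover₁ = begin
      x * Q₁ + D * (Q₀ * Y - Q₁ * X) * P₁
        ≡⟨ cong (λ z → z * Q₁ + D * (Q₀ * Y - Q₁ * X) * P₁) x≡ ⟩
      D * (X * P₁ - Y * P₀) * Q₁ + D * (Q₀ * Y - Q₁ * X) * P₁
        ≡⟨ solve (D ∷ X ∷ Y ∷ P₀ ∷ P₁ ∷ Q₀ ∷ Q₁ ∷ []) ⟩
      D * (Y * (P₁ * Q₀ - P₀ * Q₁))
        ≡⟨ undo Y ⟩
      Y ∎

  Gap : ℤ → ℤ → Set
  Gap P₀ P₁ = (+ 3 * P₀ ≤ P₁) ⊎ ((∃[ K ] P₁ ≡ K + K) × + 2 * P₀ ≤ P₁)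

module Recurrences where

  open import Data.Integer
    using (+_; 0ℤ; _+_; _*_; _≤_; _<_; +≤+)
  open import Data.Integer.Properties
  open import Data.Integer.Tactic.RingSolver using (solve-∀)
  open Arithmetic using (pos-*-+; 1≤j⇒i≤j*i)

  -- Lin g x y (2 + k) = x q_k + y p_k, the numerator of x + y p_k / q_k.
  Lin : CF → ℤ → ℤ → ℕ → ℤ
  Lin g x y k = x * + Q g k + y * + P g k

  IsSolution : CF → (ℕ → ℤ) → Set
  IsSolution g f = ∀ k → f (suc (suc k)) ≡ + g k * f (suc k) + f k

  EventuallyPositive : (ℕ → ℤ) → Set
  EventuallyPositive f = ∃[ k ] (0ℤ < f k × 0ℤ < f (suc k))

  tail : CF → ℕ → CF
  tail g m i = g (i ℕ.+ m)

  tail-valid : ∀ {g} → ValidCF g → ∀ m → ValidCF (tail g m)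
  tail-valid valid m i = valid (i ℕ.+ m)

  module _ {g : CF} (valid : ValidCF g) {f : ℕ → ℤ} (solution : IsSolution g f) where

    sum≤next : ∀ k → 0ℤ ≤ f (suc k) → f k + f (suc k) ≤ f (suc (suc k))
    sum≤next k 0≤f₁ = begin
      f k + f (suc k)          ≡⟨ +-comm (f k) (f (suc k)) ⟩
      f (suc k) + f k          ≤⟨ +-monoˡ-≤ (f k) f₁≤gf₁ ⟩
      + g k * f (suc k) + f k  ≡⟨ solution k ⟨
      f (suc (suc k))          ∎
      where
      open ≤-Reasoning
      f₁≤gf₁ : f (suc k) ≤ + g k * f (suc k)
      f₁≤gf₁ = 1≤j⇒i≤j*i (+≤+ (valid k)) 0≤f₁

    next≤0 : ∀ k → f k ≤ 0ℤ → f (suc k) ≤ 0ℤ → f (suc (suc k)) ≤ 0ℤ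
    next≤0 k f₀≤0 f₁≤0 = begin
      f (suc (suc k))          ≡⟨ solution k ⟩
      + g k * f (suc k) + f k  ≤⟨ +-mono-≤ (*-monoˡ-≤-nonNeg (+ g k) f₁≤0) f₀≤0 ⟩
      + g k * 0ℤ + 0ℤ          ≡⟨ cong (_+ 0ℤ) (*-zeroʳ (+ g k)) ⟩
      0ℤ                       ∎
      where open ≤-Reasoning

    positivity-persists : ∀ {k} → 0ℤ < f k → 0ℤ < f (suc k) →
                          ∀ i → 0ℤ < f (i ℕ.+ k) × 0ℤ < f (suc (i ℕ.+ k))
    positivity-persists 0<f₀ 0<f₁ zero = 0<f₀ , 0<f₁
    positivity-persists {k} 0<f₀ 0<f₁ (suc i) =
      let 0<fᵢ , 0<fᵢ₊₁ = positivity-persists 0<f₀ 0<f₁ i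
      in 0<fᵢ₊₁ , <-≤-trans (+-mono-< 0<fᵢ 0<fᵢ₊₁) (sum≤next (i ℕ.+ k) (<⇒≤ 0<fᵢ₊₁))

    nonpositivity-persists : f 0 ≤ 0ℤ → f 1 ≤ 0ℤ → ∀ k → f k ≤ 0ℤ × f (suc k) ≤ 0ℤ
    nonpositivity-persists f₀≤0 f₁≤0 zero = f₀≤0 , f₁≤0
    nonpositivity-persists f₀≤0 f₁≤0 (suc k) =
      let fₖ≤0 , fₖ₊₁≤0 = nonpositivity-persists f₀≤0 f₁≤0 k
      in fₖ₊₁≤0 , next≤0 k fₖ≤0 fₖ₊₁≤0

    eventuallyPositive-intro : ∀ k → 0ℤ ≤ f k → 0ℤ ≤ f (suc k) → 0ℤ < f k + f (suc k) →
                               EventuallyPositive f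
    eventuallyPositive-intro k 0≤f₀ 0≤f₁ 0<f₀+f₁ = suc (suc k) , 0<f₂ , 0<f₃
      where
      0<f₂ : 0ℤ < f (suc (suc k))
      0<f₂ = <-≤-trans 0<f₀+f₁ (sum≤next k 0≤f₁)
      0<f₃ : 0ℤ < f (suc (suc (suc k)))
      0<f₃ = <-≤-trans (+-mono-≤-< 0≤f₁ 0<f₂) (sum≤next (suc k) (<⇒≤ 0<f₂))

    ¬eventuallyPositive : f 0 ≤ 0ℤ → f 1 ≤ 0ℤ → ¬ EventuallyPositive f
    ¬eventuallyPositive f₀≤0 f₁≤0 (k , 0<fₖ , _) =
      <⇒≱ 0<fₖ (proj₁ (nonpositivity-persists f₀≤0 f₁≤0 k))

    eventuallyPositive-shift : ∀ m → EventuallyPositive f ⇔ EventuallyPositive (λ k → f (k ℕ.+ m))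
    eventuallyPositive-shift m = mk⇔ forward (λ (k , 0<fₖ , 0<fₖ₊₁) → k ℕ.+ m , 0<fₖ , 0<fₖ₊₁)
      where
      forward : EventuallyPositive f → EventuallyPositive (λ k → f (k ℕ.+ m))
      forward (k , 0<fₖ , 0<fₖ₊₁) =
        let 0<fₘ₊ₖ , 0<fₘ₊ₖ₊₁ = positivity-persists 0<fₖ 0<fₖ₊₁ m
        in k , subst (λ i → 0ℤ < f i) (ℕ.+-comm m k) 0<fₘ₊ₖ
             , subst (λ i → 0ℤ < f (suc i)) (ℕ.+-comm m k) 0<fₘ₊ₖ₊₁

  eventuallyPositive-+ : ∀ {g f h} → ValidCF g → IsSolution g f → IsSolution g h →
                         EventuallyPositive f → EventuallyPositive h →
                         EventuallyPositive (λ k → f k + h k)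
  eventuallyPositive-+ {f = f} {h} valid solf solh (k , 0<fₖ , 0<fₖ₊₁) (l , 0<hₗ , 0<hₗ₊₁) =
    let 0<f , 0<f' = positivity-persists valid solf 0<fₖ 0<fₖ₊₁ l
        0<h , 0<h' = positivity-persists valid solh 0<hₗ 0<hₗ₊₁ k
    in l ℕ.+ k
     , +-mono-< 0<f (subst (λ i → 0ℤ < h i) (ℕ.+-comm k l) 0<h)
     , +-mono-< 0<f' (subst (λ i → 0ℤ < h (suc i)) (ℕ.+-comm k l) 0<h')

  eventuallyPositive-cong : ∀ {f h} → (∀ k → f k ≡ h k) → EventuallyPositive f ⇔ EventuallyPositive h
  eventuallyPositive-cong f≗h = mk⇔ (transport f≗h) (transport (sym ∘ f≗h))
    where
    transport : ∀ {f h} → (∀ k → f k ≡ h k) → EventuallyPositive f → EventuallyPositive h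
    transport f≗h (k , 0<fₖ , 0<fₖ₊₁) = k , subst (0ℤ <_) (f≗h k) 0<fₖ , subst (0ℤ <_) (f≗h (suc k)) 0<fₖ₊₁

  solutions-agree : ∀ {g f h} → IsSolution g f → IsSolution g h → f 0 ≡ h 0 → f 1 ≡ h 1 →
                    ∀ k → f k ≡ h k
  solutions-agree {g} {f} {h} solf solh f₀≡h₀ f₁≡h₁ k = proj₁ (agree k)
    where
    agree : ∀ k → f k ≡ h k × f (suc k) ≡ h (suc k)
    agree zero = f₀≡h₀ , f₁≡h₁
    agree (suc k) =
      let fₖ≡hₖ , fₖ₊₁≡hₖ₊₁ = agree k
      in fₖ₊₁≡hₖ₊₁ , trans (solf k) (trans (cong₂ (λ u v → + g k * u + v) fₖ₊₁≡hₖ₊₁ fₖ≡hₖ) (sym (solh k)))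

  Lin-solution : ∀ g x y → IsSolution g (Lin g x y)
  Lin-solution g x y k = begin
    x * + Q g (2 ℕ.+ k) + y * + P g (2 ℕ.+ k)
      ≡⟨ cong₂ (λ u v → x * u + y * v) (pos-*-+ (g k) (Q g (suc k)) (Q g k))
                                       (pos-*-+ (g k) (P g (suc k)) (P g k)) ⟩
    x * (G * Q₁ + Q₀) + y * (G * P₁ + P₀)
      ≡⟨ regroup x y G Q₁ Q₀ P₁ P₀ ⟩
    G * (x * Q₁ + y * P₁) + (x * Q₀ + y * P₀) ∎
    where
    open ≡-Reasoning
    G = + g k
    Q₁ = + Q g (suc k)
    Q₀ = + Q g k
    P₁ = + P g (suc k)
    P₀ = + P g k
    regroup : ∀ x y G Q₁ Q₀ P₁ P₀ →
              x * (G * Q₁ + Q₀) + y * (G * P₁ + P₀) ≡ G * (x * Q₁ + y * P₁) + (x * Q₀ + y * P₀)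
    regroup = solve-∀

  Lin-+ : ∀ g x y x' y' k → Lin g (x + x') (y + y') k ≡ Lin g x y k + Lin g x' y' k
  Lin-+ g x y x' y' k = distrib x y x' y' (+ Q g k) (+ P g k)
    where
    distrib : ∀ x y x' y' Q P → (x + x') * Q + (y + y') * P ≡ (x * Q + y * P) + (x' * Q + y' * P)
    distrib = solve-∀

  Lin-at-0 : ∀ g x y → Lin g x y 0 ≡ x
  Lin-at-0 g x y = trans (cong₂ _+_ (*-identityʳ x) (*-zeroʳ y)) (+-identityʳ x)

  Lin-at-1 : ∀ g x y → Lin g x y 1 ≡ y
  Lin-at-1 g x y = trans (cong₂ _+_ (*-zeroʳ x) (*-identityʳ y)) (+-identityˡ y)

  Lin-tail : ∀ g x y m k → Lin g x y (k ℕ.+ m) ≡ Lin (tail g m) (Lin g x y m) (Lin g x y (suc m)) k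
  Lin-tail g x y m =
    solutions-agree {tail g m} {λ k → Lin g x y (k ℕ.+ m)} {Lin (tail g m) X Y}
      (λ k → Lin-solution g x y (k ℕ.+ m)) (Lin-solution (tail g m) X Y)
      (sym (Lin-at-0 (tail g m) X Y)) (sym (Lin-at-1 (tail g m) X Y))
    where
    X = Lin g x y m
    Y = Lin g x y (suc m)

  module _ {g : CF} (valid : ValidCF g) where

    PosLin⇔eventuallyPositive : ∀ x y → PosLin g x y ⇔ EventuallyPositive (Lin g x y)
    PosLin⇔eventuallyPositive x y =
      mk⇔ (λ (k , 0<fₖ , 0<fₖ₊₁) → suc (suc k) , 0<fₖ , 0<fₖ₊₁)
          (λ (k , 0<fₖ , 0<fₖ₊₁) → k , positivity-persists valid (Lin-solution g x y) 0<fₖ 0<fₖ₊₁ 2)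

    PosLin-+ : ∀ {x y x' y'} → PosLin g x y → PosLin g x' y' → PosLin g (x + x') (y + y')
    PosLin-+ {x} {y} {x'} {y'} pos pos' =
      Equivalence.from (PosLin⇔eventuallyPositive (x + x') (y + y'))
        (Equivalence.to (eventuallyPositive-cong (λ k → sym (Lin-+ g x y x' y' k)))
          (eventuallyPositive-+ valid (Lin-solution g x y) (Lin-solution g x' y')
            (Equivalence.to (PosLin⇔eventuallyPositive x y) pos)
            (Equivalence.to (PosLin⇔eventuallyPositive x' y') pos')))

    PosLin-nonpos : ∀ {x y} → PosLin g x y → x ≤ 0ℤ → y ≤ 0ℤ → ⊥
    PosLin-nonpos {x} {y} pos x≤0 y≤0 =
      ¬eventuallyPositive valid (Lin-solution g x y)
        (subst (_≤ 0ℤ) (sym (Lin-at-0 g x y)) x≤0) (subst (_≤ 0ℤ) (sym (Lin-at-1 g x y)) y≤0)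
        (Equivalence.to (PosLin⇔eventuallyPositive x y) pos)

    PosLin-quadrant : ∀ {x y} → 0ℤ < x → 0ℤ ≤ y → PosLin g x y
    PosLin-quadrant {x} {y} 0<x 0≤y =
      Equivalence.from (PosLin⇔eventuallyPositive x y)
        (eventuallyPositive-intro valid (Lin-solution g x y) 0
          (subst (0ℤ ≤_) (sym (Lin-at-0 g x y)) (<⇒≤ 0<x))
          (subst (0ℤ ≤_) (sym (Lin-at-1 g x y)) 0≤y)
          (subst (0ℤ <_) (sym (cong₂ _+_ (Lin-at-0 g x y) (Lin-at-1 g x y))) (+-mono-<-≤ 0<x 0≤y)))

    -- ζ > 1 enters here: the next term g₀ y + x is at least x + y.
    PosLin-slope : ∀ {x y} → 0ℤ < y → 0ℤ ≤ x + y → PosLin g x y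
    PosLin-slope {x} {y} 0<y 0≤x+y =
      Equivalence.from (PosLin⇔eventuallyPositive x y)
        (eventuallyPositive-intro valid solution 1 (<⇒≤ 0<f₁) 0≤f₂ (+-mono-<-≤ 0<f₁ 0≤f₂))
      where
      f = Lin g x y
      solution = Lin-solution g x y
      0<f₁ : 0ℤ < f 1
      0<f₁ = subst (0ℤ <_) (sym (Lin-at-1 g x y)) 0<y
      0≤f₂ : 0ℤ ≤ f 2
      0≤f₂ = ≤-trans (subst (0ℤ ≤_) (sym (cong₂ _+_ (Lin-at-0 g x y) (Lin-at-1 g x y))) 0≤x+y)
                     (sum≤next valid solution 0 (<⇒≤ 0<f₁))

  -- α = [g₀; …, g_{m-1}, ζ] with ζ = [g_m; g_{m+1}, …], and x + yα has the sign of X + Yζ.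
  PosLin-tail : ∀ {g} → ValidCF g → ∀ m x y →
                PosLin g x y ⇔ PosLin (tail g m) (Lin g x y m) (Lin g x y (suc m))
  PosLin-tail {g} valid m x y =
    ⇔.trans (PosLin⇔eventuallyPositive valid x y)
    (⇔.trans (eventuallyPositive-shift valid (Lin-solution g x y) m)
    (⇔.trans (eventuallyPositive-cong (Lin-tail g x y m))
             (⇔.sym (PosLin⇔eventuallyPositive (tail-valid valid m) (Lin g x y m) (Lin g x y (suc m))))))

  -- Pos u v stands for u + vζ > 0, for some irrational ζ > 1.
  record HalfPlane (Pos : ℤ → ℤ → Set) : Set where
    field
      +-closed        : ∀ {u v u' v'} → Pos u v → Pos u' v' → Pos (u + u') (v + v')
      nonpos-excluded : ∀ {u v} → Pos u v → u ≤ 0ℤ → v ≤ 0ℤ → ⊥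
      quadrant        : ∀ {u v} → 0ℤ < u → 0ℤ ≤ v → Pos u v
      slope           : ∀ {u v} → 0ℤ < v → 0ℤ ≤ u + v → Pos u v

  PosLin-half-plane : ∀ {g} → ValidCF g → HalfPlane (PosLin g)
  PosLin-half-plane valid = record
    { +-closed        = λ {x} {y} {x'} {y'} → PosLin-+ valid {x} {y} {x'} {y'}
    ; nonpos-excluded = λ {x} {y} → PosLin-nonpos valid {x} {y}
    ; quadrant        = λ {x} {y} → PosLin-quadrant valid {x} {y}
    ; slope           = λ {x} {y} → PosLin-slope valid {x} {y}
    }

module Windows {Pos : ℤ → ℤ → Set} (half-plane : Recurrences.HalfPlane Pos) where

  open import Data.Integer
    using (+_; -[1+_]; 0ℤ; 1ℤ; -1ℤ; _+_; _-_; -_; _*_; _≤_; _<_; +≤+; +<+; -≤-; -≤+; nonNegative)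
  open import Data.Integer.Properties
  open import Data.Integer.Tactic.RingSolver using (solve)
  open Arithmetic
  open Recurrences.HalfPlane half-plane

  -- With L = P₀ + P₁ζ, Window P₀ P₁ X Y says 0 < X + Yζ < L/2; the height of (X, Y) is X P₁ - Y P₀.
  record Window (P₀ P₁ X Y : ℤ) : Set where
    constructor window
    field
      lower : Pos X Y
      upper : Pos (P₀ - (X + X)) (P₁ - (Y + Y))

  WindowHeight : (P₀ P₁ M : ℤ) → Set
  WindowHeight P₀ P₁ M = ∃[ X ] ∃[ Y ] (Window P₀ P₁ X Y × X * P₁ - Y * P₀ ≡ M)

  WindowPair : (P₀ P₁ σ : ℤ) → Set
  WindowPair P₀ P₁ σ = ∃[ M₁ ] ∃[ M₂ ] (0ℤ < M₁ × 0ℤ < M₂ × M₁ ≢ M₂ × M₁ + M₂ ≡ P₀ + P₀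
                         × WindowHeight P₀ P₁ (σ * M₁) × WindowHeight P₀ P₁ (σ * M₂))

  module Obstruction {P₀ P₁ : ℤ} (0<P₀ : 0ℤ < P₀) (P₀<P₁ : P₀ < P₁) (coprime : Coprime P₀ P₁)
    where

    0≤P₀ : 0ℤ ≤ P₀
    0≤P₀ = <⇒≤ 0<P₀

    0≤P₁ : 0ℤ ≤ P₁
    0≤P₁ = <⇒≤ (<-trans 0<P₀ P₀<P₁)

    2≤P₁ : + 2 ≤ P₁
    2≤P₁ = i<j⇒suc[i]≤j (≤-<-trans (i<j⇒suc[i]≤j 0<P₀) P₀<P₁)

    Pos⇒0<v : ∀ {u v} → Pos u v → u ≤ 0ℤ → 0ℤ < v
    Pos⇒0<v p u≤0 = ≰⇒> (nonpos-excluded p u≤0)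

    Pos⇒0<u : ∀ {u v} → Pos u v → v ≤ 0ℤ → 0ℤ < u
    Pos⇒0<u p v≤0 = ≰⇒> λ u≤0 → nonpos-excluded p u≤0 v≤0

    sum-is-multiple : ∀ X₁ Y₁ X₂ Y₂ {H₁ H₂} E →
                      X₁ * P₁ - Y₁ * P₀ ≡ H₁ → X₂ * P₁ - Y₂ * P₀ ≡ H₂ → H₁ + H₂ ≡ E * P₀ →
                      ∃[ c ] (X₁ + X₂ ≡ c * P₀ × Y₁ + Y₂ ≡ c * P₁ - E)
    sum-is-multiple X₁ Y₁ X₂ Y₂ E h₁ h₂ ΣH =
      let c , ΣX , ΣY+E = coprime⇒proportional (X₁ + X₂) (Y₁ + Y₂ + E) coprime proportional
      in c , ΣX , (begin
           Y₁ + Y₂             ≡⟨ solve (Y₁ ∷ Y₂ ∷ E ∷ []) ⟩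
           (Y₁ + Y₂ + E) - E   ≡⟨ cong (_- E) ΣY+E ⟩
           c * P₁ - E          ∎)
      where
      open ≡-Reasoning
      proportional : (X₁ + X₂) * P₁ ≡ (Y₁ + Y₂ + E) * P₀
      proportional = begin
        (X₁ + X₂) * P₁
          ≡⟨ solve (X₁ ∷ X₂ ∷ Y₁ ∷ Y₂ ∷ P₀ ∷ P₁ ∷ []) ⟩
        (X₁ * P₁ - Y₁ * P₀) + (X₂ * P₁ - Y₂ * P₀) + (Y₁ + Y₂) * P₀
          ≡⟨ cong (_+ (Y₁ + Y₂) * P₀) (trans (cong₂ _+_ h₁ h₂) ΣH) ⟩
        E * P₀ + (Y₁ + Y₂) * P₀
          ≡⟨ solve (E ∷ Y₁ ∷ Y₂ ∷ P₀ ∷ []) ⟩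
        (Y₁ + Y₂ + E) * P₀ ∎

    multiple-below : ∀ {d f} → d ≤ -1ℤ → f ≤ P₁ → d * P₀ ≤ 0ℤ × d * P₁ + f ≤ 0ℤ
    multiple-below {d} {f} d≤-1 f≤P₁ =
        ≤-trans (j≤-1⇒j*i≤-i d≤-1 0≤P₀) (neg-mono-≤ 0≤P₀)
      , (begin
          d * P₁ + f  ≤⟨ +-mono-≤ (j≤-1⇒j*i≤-i d≤-1 0≤P₁) f≤P₁ ⟩
          - P₁ + P₁   ≡⟨ +-inverseˡ P₁ ⟩
          0ℤ          ∎)
      where open ≤-Reasoning

    -- Two window points add up to a point of (0, L), which pins down the multiple of L in cL + eζ.
    sum-of-windows : ∀ {X₁ Y₁ X₂ Y₂} c e → e ≤ P₁ → - e ≤ P₁ →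
                     Window P₀ P₁ X₁ Y₁ → Window P₀ P₁ X₂ Y₂ →
                     X₁ + X₂ ≡ c * P₀ → Y₁ + Y₂ ≡ c * P₁ + e →
                     (c ≡ 0ℤ × 0ℤ < e) ⊎ (c ≡ 1ℤ × e < 0ℤ)
    sum-of-windows {X₁} {Y₁} {X₂} {Y₂} c e e≤P₁ -e≤P₁ (window p₁ q₁) (window p₂ q₂) ΣX ΣY =
      index c (subst₂ Pos ΣX ΣY (+-closed p₁ p₂)) (subst₂ Pos complementX complementY (+-closed q₁ q₂))
      where
      open ≡-Reasoning
      complementX : (P₀ - (X₁ + X₁)) + (P₀ - (X₂ + X₂)) ≡ (1ℤ - c) * P₀ + (1ℤ - c) * P₀
      complementX = begin
        (P₀ - (X₁ + X₁)) + (P₀ - (X₂ + X₂))  ≡⟨ solve (P₀ ∷ X₁ ∷ X₂ ∷ []) ⟩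
        (P₀ - (X₁ + X₂)) + (P₀ - (X₁ + X₂))  ≡⟨ cong (λ t → (P₀ - t) + (P₀ - t)) ΣX ⟩
        (P₀ - c * P₀) + (P₀ - c * P₀)        ≡⟨ solve (P₀ ∷ c ∷ []) ⟩
        (1ℤ - c) * P₀ + (1ℤ - c) * P₀        ∎
      complementY : (P₁ - (Y₁ + Y₁)) + (P₁ - (Y₂ + Y₂)) ≡ ((1ℤ - c) * P₁ - e) + ((1ℤ - c) * P₁ - e)
      complementY = begin
        (P₁ - (Y₁ + Y₁)) + (P₁ - (Y₂ + Y₂))   ≡⟨ solve (P₁ ∷ Y₁ ∷ Y₂ ∷ []) ⟩
        (P₁ - (Y₁ + Y₂)) + (P₁ - (Y₁ + Y₂))   ≡⟨ cong (λ t → (P₁ - t) + (P₁ - t)) ΣY ⟩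
        (P₁ - (c * P₁ + e)) + (P₁ - (c * P₁ + e)) ≡⟨ solve (P₁ ∷ c ∷ e ∷ []) ⟩
        ((1ℤ - c) * P₁ - e) + ((1ℤ - c) * P₁ - e) ∎
      index : ∀ c → Pos (c * P₀) (c * P₁ + e) →
              Pos ((1ℤ - c) * P₀ + (1ℤ - c) * P₀) (((1ℤ - c) * P₁ - e) + ((1ℤ - c) * P₁ - e)) →
              (c ≡ 0ℤ × 0ℤ < e) ⊎ (c ≡ 1ℤ × e < 0ℤ)
      index (+ zero) lower _ = inj₁ (refl , subst (0ℤ <_) (+-identityˡ e) (Pos⇒0<v lower ≤-refl))
      index (+ suc zero) _ upper =
        inj₂ (refl , neg-cancel-< (0<i+i⇒0<i (subst (0ℤ <_) (cong₂ _+_ (+-identityˡ (- e)) (+-identityˡ (- e)))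
                                                 (Pos⇒0<v upper ≤-refl))))
      index (+ suc (suc j)) _ upper =
        let d≤0 , f≤0 = multiple-below {d = -[1+ j ]} (-≤- z≤n) -e≤P₁
        in ⊥-elim (nonpos-excluded upper (+-mono-≤ d≤0 d≤0) (+-mono-≤ f≤0 f≤0))
      index -[1+ j ] lower _ =
        let d≤0 , f≤0 = multiple-below {d = -[1+ j ]} (-≤- z≤n) e≤P₁
        in ⊥-elim (nonpos-excluded lower d≤0 f≤0)

    height-positive : ∀ {X Y} → 1ℤ ≤ X → Y ≤ 1ℤ → 0ℤ < X * P₁ - Y * P₀
    height-positive {X} {Y} 1≤X Y≤1 = i<j⇒0<j-i (begin-strict
      Y * P₀   ≤⟨ *-monoʳ-≤-nonNeg P₀ {{nonNegative 0≤P₀}} Y≤1 ⟩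
      1ℤ * P₀  ≡⟨ *-identityˡ P₀ ⟩
      P₀       <⟨ P₀<P₁ ⟩
      P₁       ≤⟨ 1≤j⇒i≤j*i 1≤X 0≤P₁ ⟩
      X * P₁   ∎)
      where open ≤-Reasoning

    negative-height⇒X≤0 : ∀ X Y → X * P₁ - Y * P₀ < 0ℤ → Y ≤ 1ℤ → X ≤ 0ℤ
    negative-height⇒X≤0 X Y negative Y≤1 =
      ≮⇒≥ λ 0<X → <-asym (height-positive (i<j⇒suc[i]≤j 0<X) Y≤1) negative

    negative-height⇒1≤Y : ∀ X Y → Window P₀ P₁ X Y → X * P₁ - Y * P₀ < 0ℤ → 1ℤ ≤ Y
    negative-height⇒1≤Y X Y (window p _) negative = i<j⇒suc[i]≤j (≰⇒> λ Y≤0 →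
      <-asym (height-positive (i<j⇒suc[i]≤j (Pos⇒0<u p Y≤0)) (≤-trans Y≤0 (+≤+ z≤n))) negative)

    -- The two points add up to 2ζ, which forces both of them to be (0, 1).
    negative-pair-impossible : ¬ WindowPair P₀ P₁ -1ℤ
    negative-pair-impossible
      (M₁ , M₂ , 0<M₁ , 0<M₂ , M₁≢M₂ , ΣM , (X₁ , Y₁ , w₁ , h₁) , (X₂ , Y₂ , w₂ , h₂))
      with sum-is-multiple X₁ Y₁ X₂ Y₂ (- + 2) (trans h₁ (-1*i≡-i M₁)) (trans h₂ (-1*i≡-i M₂)) ΣH
      where
      ΣH : - M₁ + - M₂ ≡ - + 2 * P₀
      ΣH = trans (sym (neg-distrib-+ M₁ M₂)) (trans (cong -_ ΣM) (solve (P₀ ∷ [])))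
    ... | c , ΣX , ΣY with sum-of-windows c (+ 2) 2≤P₁ (≤-trans -≤+ 0≤P₁) w₁ w₂ ΣX ΣY
    ... | inj₂ (_ , +<+ ())
    ... | inj₁ (refl , _) = M₁≢M₂ (neg-injective (begin
      - M₁               ≡⟨ h₁' ⟨
      X₁ * P₁ - Y₁ * P₀  ≡⟨ cong₂ (λ X Y → X * P₁ - Y * P₀) (trans X₁≡0 (sym X₂≡0)) (trans Y₁≡1 (sym Y₂≡1)) ⟩
      X₂ * P₁ - Y₂ * P₀  ≡⟨ h₂' ⟩
      - M₂               ∎))
      where
      open ≡-Reasoning
      h₁' = trans h₁ (-1*i≡-i M₁)
      h₂' = trans h₂ (-1*i≡-i M₂)
      negative₁ = subst (_< 0ℤ) (sym h₁') (neg-mono-< 0<M₁)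
      negative₂ = subst (_< 0ℤ) (sym h₂') (neg-mono-< 0<M₂)
      1≤Y₁ = negative-height⇒1≤Y X₁ Y₁ w₁ negative₁
      1≤Y₂ = negative-height⇒1≤Y X₂ Y₂ w₂ negative₂
      Y₁≡1 : Y₁ ≡ 1ℤ
      Y₁≡1 = squeeze-≥ 1≤Y₁ 1≤Y₂ ΣY
      Y₂≡1 : Y₂ ≡ 1ℤ
      Y₂≡1 = squeeze-≥ 1≤Y₂ 1≤Y₁ (trans (+-comm Y₂ Y₁) ΣY)
      X₁≤0 = negative-height⇒X≤0 X₁ Y₁ negative₁ (≤-reflexive Y₁≡1)
      X₂≤0 = negative-height⇒X≤0 X₂ Y₂ negative₂ (≤-reflexive Y₂≡1)
      X₁≡0 : X₁ ≡ 0ℤ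
      X₁≡0 = squeeze-≤ X₁≤0 X₂≤0 ΣX
      X₂≡0 : X₂ ≡ 0ℤ
      X₂≡0 = squeeze-≤ X₂≤0 X₁≤0 (trans (+-comm X₂ X₁) ΣX)

    gap-bound : ∀ Y → Gap P₀ P₁ → 0ℤ < P₁ - (Y + Y) → (P₀ + P₀) + (P₀ + P₀) ≤ P₁ + (P₁ - (Y + Y)) * P₀
    gap-bound Y (inj₁ 3P₀≤P₁) 0<w = begin
      (P₀ + P₀) + (P₀ + P₀)     ≡⟨ solve (P₀ ∷ []) ⟩
      + 3 * P₀ + 1ℤ * P₀        ≤⟨ +-mono-≤ 3P₀≤P₁ (*-monoʳ-≤-nonNeg P₀ {{nonNegative 0≤P₀}} 1≤w) ⟩
      P₁ + (P₁ - (Y + Y)) * P₀  ∎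
      where
      open ≤-Reasoning
      1≤w : 1ℤ ≤ P₁ - (Y + Y)
      1≤w = i<j⇒suc[i]≤j 0<w
    gap-bound Y (inj₂ ((K , P₁≡K+K) , 2P₀≤P₁)) 0<w = begin
      (P₀ + P₀) + (P₀ + P₀)       ≡⟨ solve (P₀ ∷ []) ⟩
      + 2 * P₀ + + 2 * P₀         ≤⟨ +-mono-≤ 2P₀≤P₁ (*-monoʳ-≤-nonNeg P₀ {{nonNegative 0≤P₀}} 2≤w) ⟩
      P₁ + (P₁ - (Y + Y)) * P₀    ∎
      where
      open ≤-Reasoning
      w≡ : P₁ - (Y + Y) ≡ (K - Y) + (K - Y)
      w≡ = trans (cong (_- (Y + Y)) P₁≡K+K) (solve (K ∷ Y ∷ []))
      1≤K-Y : 1ℤ ≤ K - Y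
      1≤K-Y = i<j⇒suc[i]≤j (0<i+i⇒0<i (subst (0ℤ <_) w≡ 0<w))
      2≤w : + 2 ≤ P₁ - (Y + Y)
      2≤w = subst (+ 2 ≤_) (sym w≡) (+-mono-≤ 1≤K-Y 1≤K-Y)

    wide-point-height : ∀ X Y → Gap P₀ P₁ → Window P₀ P₁ X Y → P₀ < X + X → P₀ + P₀ ≤ X * P₁ - Y * P₀
    wide-point-height X Y gap (window _ q) P₀<X+X = i+i≤j+j⇒i≤j (begin
      (P₀ + P₀) + (P₀ + P₀)                    ≤⟨ gap-bound Y gap 0<w ⟩
      P₁ + (P₁ - (Y + Y)) * P₀                 ≤⟨ +-monoˡ-≤ ((P₁ - (Y + Y)) * P₀) (1≤j⇒i≤j*i 1≤u 0≤P₁) ⟩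
      (X + X - P₀) * P₁ + (P₁ - (Y + Y)) * P₀  ≡⟨ solve (X ∷ Y ∷ P₀ ∷ P₁ ∷ []) ⟩
      (X * P₁ - Y * P₀) + (X * P₁ - Y * P₀)    ∎)
      where
      open ≤-Reasoning
      1≤u : 1ℤ ≤ X + X - P₀
      1≤u = i<j⇒suc[i]≤j (i<j⇒0<j-i P₀<X+X)
      0<w : 0ℤ < P₁ - (Y + Y)
      0<w = Pos⇒0<v q (i≤j⇒i-j≤0 (<⇒≤ P₀<X+X))

    odd-split : ∀ X₁ X₂ H → P₀ ≡ H + H + 1ℤ → X₁ + X₂ ≡ P₀ → P₀ < X₁ + X₁ ⊎ P₀ < X₂ + X₂
    odd-split X₁ X₂ H P₀-odd ΣX with <-cmp P₀ (X₁ + X₁)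
    ... | tri< P₀<2X₁ _ _ = inj₁ P₀<2X₁
    ... | tri≈ _ P₀≡2X₁ _ = ⊥-elim (i+i≢j+j+1 X₁ H (trans (sym P₀≡2X₁) P₀-odd))
    ... | tri> _ _ 2X₁<P₀ = inj₂ (≰⇒> λ 2X₂≤P₀ → <-irrefl doubled (+-mono-<-≤ 2X₁<P₀ 2X₂≤P₀))
      where
      doubled : (X₁ + X₁) + (X₂ + X₂) ≡ P₀ + P₀
      doubled = begin
        (X₁ + X₁) + (X₂ + X₂)  ≡⟨ solve (X₁ ∷ X₂ ∷ []) ⟩
        (X₁ + X₂) + (X₁ + X₂)  ≡⟨ cong₂ _+_ ΣX ΣX ⟩
        P₀ + P₀                ∎
        where open ≡-Reasoning

    wide-point-impossible : ∀ X Y {M M'} → Gap P₀ P₁ → Window P₀ P₁ X Y → X * P₁ - Y * P₀ ≡ 1ℤ * M →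
                            M + M' ≡ P₀ + P₀ → 0ℤ < M' → P₀ < X + X → ⊥
    wide-point-impossible X Y {M} {M'} gap w h ΣM 0<M' P₀<2X = <-irrefl (sym ΣM) (begin-strict
      P₀ + P₀       ≡⟨ +-identityʳ (P₀ + P₀) ⟨
      P₀ + P₀ + 0ℤ  <⟨ +-mono-≤-< 2P₀≤M 0<M' ⟩
      M + M'        ∎)
      where
      open ≤-Reasoning
      2P₀≤M : P₀ + P₀ ≤ M
      2P₀≤M = subst (P₀ + P₀ ≤_) (trans h (*-identityˡ M)) (wide-point-height X Y gap w P₀<2X)

    -- The two points add up to L - 2ζ, and the one with 2X > P₀ has height at least 2P₀.
    positive-pair-impossible : ∀ H → P₀ ≡ H + H + 1ℤ → Gap P₀ P₁ → ¬ WindowPair P₀ P₁ 1ℤ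
    positive-pair-impossible H P₀-odd gap
      (M₁ , M₂ , 0<M₁ , 0<M₂ , _ , ΣM , (X₁ , Y₁ , w₁ , h₁) , (X₂ , Y₂ , w₂ , h₂))
      with sum-is-multiple X₁ Y₁ X₂ Y₂ (+ 2) (trans h₁ (*-identityˡ M₁)) (trans h₂ (*-identityˡ M₂))
                      (trans ΣM (solve (P₀ ∷ [])))
    ... | c , ΣX , ΣY with sum-of-windows c (- + 2) (≤-trans -≤+ 0≤P₁) 2≤P₁ w₁ w₂ ΣX ΣY
    ... | inj₁ (_ , ())
    ... | inj₂ (refl , _) with odd-split X₁ X₂ H P₀-odd (trans ΣX (*-identityˡ P₀))
    ...   | inj₁ P₀<2X₁ = wide-point-impossible X₁ Y₁ gap w₁ h₁ ΣM 0<M₂ P₀<2X₁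
    ...   | inj₂ P₀<2X₂ = wide-point-impossible X₂ Y₂ gap w₂ h₂ (trans (+-comm M₂ M₁) ΣM) 0<M₁ P₀<2X₂

  pair-from-points : ∀ {P₀ P₁} X₁ Y₁ X₂ Y₂ →
                     Window P₀ P₁ X₁ Y₁ → Window P₀ P₁ X₂ Y₂ → X₁ + X₂ ≡ P₀ → Y₁ + Y₂ + + 2 ≡ P₁ →
                     0ℤ < X₂ * P₁ - Y₂ * P₀ → 0ℤ < (X₁ * P₁ - Y₁ * P₀) - (X₂ * P₁ - Y₂ * P₀) →
                     WindowPair P₀ P₁ 1ℤ
  pair-from-points {P₀} {P₁} X₁ Y₁ X₂ Y₂ w₁ w₂ ΣX ΣY 0<M₂ 0<M₁-M₂ =
    M₁ , M₂ , <-trans 0<M₂ M₂<M₁ , 0<M₂ , (λ M₁≡M₂ → <-irrefl (sym M₁≡M₂) M₂<M₁) , ΣM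
       , (X₁ , Y₁ , w₁ , sym (*-identityˡ M₁)) , (X₂ , Y₂ , w₂ , sym (*-identityˡ M₂))
    where
    open ≡-Reasoning
    M₁ = X₁ * P₁ - Y₁ * P₀
    M₂ = X₂ * P₁ - Y₂ * P₀
    M₂<M₁ : M₂ < M₁
    M₂<M₁ = 0<j-i⇒i<j 0<M₁-M₂
    ΣM : M₁ + M₂ ≡ P₀ + P₀
    ΣM = begin
      (X₁ * P₁ - Y₁ * P₀) + (X₂ * P₁ - Y₂ * P₀)         ≡⟨ solve (X₁ ∷ Y₁ ∷ X₂ ∷ Y₂ ∷ P₀ ∷ P₁ ∷ []) ⟩
      (X₁ + X₂) * P₁ - (Y₁ + Y₂ + + 2) * P₀ + (P₀ + P₀) ≡⟨ cong₂ (λ S T → S * P₁ - T * P₀ + (P₀ + P₀)) ΣX ΣY ⟩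
      P₀ * P₁ - P₁ * P₀ + (P₀ + P₀)                      ≡⟨ solve (P₀ ∷ P₁ ∷ []) ⟩
      P₀ + P₀                                           ∎

  window-intro : ∀ {P₀ P₁ X Y} u v → 0ℤ < X → 0ℤ ≤ Y → P₀ - (X + X) ≡ u → P₁ - (Y + Y) ≡ v →
                 0ℤ < v → 0ℤ ≤ u + v → Window P₀ P₁ X Y
  window-intro u v 0<X 0≤Y u≡ v≡ 0<v 0≤u+v =
    window (quadrant 0<X 0≤Y) (subst₂ Pos (sym u≡) (sym v≡) (slope 0<v 0≤u+v))

  positive-difference : ∀ {i j} d → i < j → j - i ≡ d → 0ℤ < d
  positive-difference d i<j j-i≡d = subst (0ℤ <_) j-i≡d (i<j⇒0<j-i i<j)

  positive-resp : ∀ {i j} → 0ℤ < i → i ≡ j → 0ℤ < j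
  positive-resp 0<i i≡j = subst (0ℤ <_) i≡j 0<i

  -- The points (H, K - 1) and (H, K), of heights 3H and H.
  even-pair : ∀ H K → 0ℤ < H → H + H < K + K + 1ℤ → WindowPair (H + H) (K + K + 1ℤ) 1ℤ
  even-pair H K 0<H P₀<P₁ =
    pair-from-points {H + H} {K + K + 1ℤ} H (K - 1ℤ) H K
      (window-intro 0ℤ (+ 3) 0<H 0≤K-1 (solve (H ∷ [])) (solve (K ∷ [])) (+<+ (s≤s z≤n)) (+≤+ z≤n))
      (window-intro 0ℤ 1ℤ 0<H (<⇒≤ 0<K) (solve (H ∷ [])) (solve (K ∷ [])) (+<+ (s≤s z≤n)) (+≤+ z≤n))
      refl (solve (K ∷ []))
      (positive-resp 0<H (solve (H ∷ K ∷ [])))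
      (positive-resp (+-mono-< 0<H 0<H) (solve (H ∷ K ∷ [])))
    where
    H≤K : H ≤ K
    H≤K = 0≤i-j⇒j≤i (0<i+i+1⇒0≤i (positive-difference ((K - H) + (K - H) + 1ℤ) P₀<P₁ (solve (H ∷ K ∷ []))))
    0<K : 0ℤ < K
    0<K = <-≤-trans 0<H H≤K
    0≤K-1 : 0ℤ ≤ K - 1ℤ
    0≤K-1 = i≤j⇒0≤j-i (i<j⇒suc[i]≤j 0<K)

  -- The points (H + 1, K) and (H, K - 1), of heights H + K + 1 and 3H + 1 - K.
  odd-odd-pair : ∀ H K → H + H + 1ℤ < K + K + 1ℤ → K + K + 1ℤ < + 3 * (H + H + 1ℤ) →
                 WindowPair (H + H + 1ℤ) (K + K + 1ℤ) 1ℤ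
  odd-odd-pair H K P₀<P₁ P₁<3P₀ =
    pair-from-points {H + H + 1ℤ} {K + K + 1ℤ} (H + 1ℤ) K H (K - 1ℤ)
      (window-intro -1ℤ 1ℤ 0<H+1 (<⇒≤ 0<K) (solve (H ∷ [])) (solve (K ∷ [])) (+<+ (s≤s z≤n)) (+≤+ z≤n))
      (window-intro 1ℤ (+ 3) 0<H 0≤K-1 (solve (H ∷ [])) (solve (K ∷ [])) (+<+ (s≤s z≤n)) (+≤+ z≤n))
      (solve (H ∷ [])) (solve (K ∷ []))
      (positive-resp 0<3H+1-K (solve (H ∷ K ∷ [])))
      (positive-resp (+-mono-< 0<K-H 0<K-H) (solve (H ∷ K ∷ [])))
    where
    0<K-H : 0ℤ < K - H
    0<K-H = 0<i+i⇒0<i (positive-difference ((K - H) + (K - H)) P₀<P₁ (solve (H ∷ K ∷ [])))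
    0<3H+1-K : 0ℤ < + 3 * H + 1ℤ - K
    0<3H+1-K = 0<i+i⇒0<i (positive-difference ((+ 3 * H + 1ℤ - K) + (+ 3 * H + 1ℤ - K)) P₁<3P₀
                                                (solve (H ∷ K ∷ [])))
    0<H : 0ℤ < H
    0<H = 0<i+i⇒0<i (positive-resp (+-mono-≤-< (i≤j⇒0≤j-i (i<j⇒suc[i]≤j 0<K-H)) 0<3H+1-K) (solve (H ∷ K ∷ [])))
    0<H+1 : 0ℤ < H + 1ℤ
    0<H+1 = +-mono-< 0<H (+<+ (s≤s z≤n))
    0<K : 0ℤ < K
    0<K = positive-resp (+-mono-< 0<H 0<K-H) (solve (H ∷ K ∷ []))
    0≤K-1 : 0ℤ ≤ K - 1ℤ
    0≤K-1 = i≤j⇒0≤j-i (i<j⇒suc[i]≤j 0<K)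

  -- The points (H + 1, K - 1) and (H, K - 1), of heights 2H + K + 1 and 2H + 1 - K.
  odd-even-pair : ∀ H K → H + H + 1ℤ < K + K → K + K < + 2 * (H + H + 1ℤ) →
                  WindowPair (H + H + 1ℤ) (K + K) 1ℤ
  odd-even-pair H K P₀<P₁ P₁<2P₀ =
    pair-from-points {H + H + 1ℤ} {K + K} (H + 1ℤ) (K - 1ℤ) H (K - 1ℤ)
      (window-intro -1ℤ (+ 2) 0<H+1 0≤K-1 (solve (H ∷ [])) (solve (K ∷ [])) (+<+ (s≤s z≤n)) (+≤+ z≤n))
      (window-intro 1ℤ (+ 2) 0<H 0≤K-1 (solve (H ∷ [])) (solve (K ∷ [])) (+<+ (s≤s z≤n)) (+≤+ z≤n))
      (solve (H ∷ [])) (solve (K ∷ []))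
      (positive-resp 0<2H+1-K (solve (H ∷ K ∷ [])))
      (positive-resp (+-mono-< 0<K 0<K) (solve (H ∷ K ∷ [])))
    where
    0<K-H : 0ℤ < K - H
    0<K-H = 0<i+i-1⇒0<i (positive-difference ((K - H) + (K - H) - 1ℤ) P₀<P₁ (solve (H ∷ K ∷ [])))
    0<2H+1-K : 0ℤ < H + H + 1ℤ - K
    0<2H+1-K = 0<i+i⇒0<i (positive-difference ((H + H + 1ℤ - K) + (H + H + 1ℤ - K)) P₁<2P₀
                                                (solve (H ∷ K ∷ [])))
    0<H : 0ℤ < H
    0<H = positive-resp (+-mono-≤-< (i≤j⇒0≤j-i (i<j⇒suc[i]≤j 0<K-H)) 0<2H+1-K) (solve (H ∷ K ∷ []))
    0<H+1 : 0ℤ < H + 1ℤ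
    0<H+1 = +-mono-< 0<H (+<+ (s≤s z≤n))
    0<K : 0ℤ < K
    0<K = positive-resp (+-mono-< 0<H 0<K-H) (solve (H ∷ K ∷ []))
    0≤K-1 : 0ℤ ≤ K - 1ℤ
    0≤K-1 = i≤j⇒0≤j-i (i<j⇒suc[i]≤j 0<K)

module ContinuedFractions where

  open import Data.Integer
    using (+_; 0ℤ; 1ℤ; -1ℤ; _+_; _-_; -_; _*_; _≤_; _<_; +≤+; +<+; -<+; -≤-)
  open import Data.Integer.Properties
  open import Data.Integer.Tactic.RingSolver using (solve; solve-∀)
  open Arithmetic
  open Recurrences

  -- 0 < x + yα < α/2
  InWindow : CF → ℤ → ℤ → Set
  InWindow a x y = PosLin a x y × PosLin a (- (x + x)) (1ℤ - (y + y))

  module _ {a : CF} (valid : ValidCF a) where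

    PosLin-0⇒0< : ∀ {y} → PosLin a 0ℤ y → 0ℤ < y
    PosLin-0⇒0< {y} p = ≰⇒> (PosLin-nonpos valid {0ℤ} {y} p ≤-refl)

    0<⇒PosLin-0 : ∀ {y} → 0ℤ < y → PosLin a 0ℤ y
    0<⇒PosLin-0 {y} 0<y = PosLin-slope valid {0ℤ} {y} 0<y (subst (0ℤ ≤_) (sym (+-identityˡ y)) (<⇒≤ 0<y))

    private
      PosLin-≡ : ∀ x y x' y' → x ≡ x' → y ≡ y' → PosLin a x y → PosLin a x' y'
      PosLin-≡ x y x' y' refl refl p = p

      PosLin-+α : ∀ x y d → PosLin a x y → 0ℤ ≤ d → PosLin a x (y + d)
      PosLin-+α x y (+ zero) p _ = PosLin-≡ x y x (y + 0ℤ) refl (sym (+-identityʳ y)) p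
      PosLin-+α x y (+ suc n) p _ =
        PosLin-≡ (x + 0ℤ) (y + + suc n) x (y + + suc n) (+-identityʳ x) refl
          (PosLin-+ valid {x} {y} {0ℤ} {+ suc n} p (0<⇒PosLin-0 {+ suc n} (+<+ (s≤s z≤n))))

      PosLin-double : ∀ x y → PosLin a x y → PosLin a (x + x) (y + y)
      PosLin-double x y p = PosLin-+ valid {x} {y} {x} {y} p p

      -x-x≡-[x+x] : ∀ x → - x - x ≡ - (x + x)
      -x-x≡-[x+x] x = sym (neg-distrib-+ x x)

      -[-x-x]≡x+x : ∀ x → - (- x + - x) ≡ x + x
      -[-x-x]≡x+x x = trans (neg-distrib-+ (- x) (- x)) (cong₂ _+_ (neg-involutive x) (neg-involutive x))

      error-decreasing : ∀ m t t' → t < t' → PosLin a (+ m - + m) (- t - - t')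
      error-decreasing m t t' t<t' =
        PosLin-≡ 0ℤ (t' - t) (+ m - + m) (- t - - t') (sym (+-inverseʳ (+ m))) (solve (t ∷ t' ∷ []))
          (0<⇒PosLin-0 {t' - t} (i<j⇒0<j-i t<t'))

      ¬PosLin-0-1 : ¬ PosLin a 0ℤ -1ℤ
      ¬PosLin-0-1 p = <-asym (PosLin-0⇒0< { -1ℤ } p) (-<+ {0} {0})

    nearest⇒upper-B : ∀ m t → Nearest a m t → PosLin a (- (+ m + + m)) (1ℤ - (- t + - t))
    nearest⇒upper-B m t near with near (t + 1ℤ) (i+1≢i t)
    ... | inj₁ (closer , _) =
      ⊥-elim (¬PosLin-0-1 (PosLin-≡ (+ m - + m) (- (t + 1ℤ) - - t) 0ℤ -1ℤ
                             (+-inverseʳ (+ m)) (solve (t ∷ [])) closer))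
    ... | inj₂ (_ , farther) =
      PosLin-≡ (- + m - + m) (- - t - - (t + 1ℤ)) (- (+ m + + m)) (1ℤ - (- t + - t))
        (-x-x≡-[x+x] (+ m)) (solve (t ∷ [])) farther

    nearest⇒upper-A : ∀ m t → Nearest a m t → PosLin a (- (- + m + - + m)) (1ℤ - (t + t))
    nearest⇒upper-A m t near with near (t - 1ℤ) t-1≢t
      where
      t-1≢t : t - 1ℤ ≢ t
      t-1≢t eq = i+1≢i (t - 1ℤ) (begin
        t - 1ℤ + 1ℤ  ≡⟨ solve (t ∷ []) ⟩
        t            ≡⟨ eq ⟨
        t - 1ℤ       ∎)
        where open ≡-Reasoning
    ... | inj₁ (_ , farther) =
      PosLin-≡ (+ m + + m) (- (t - 1ℤ) + - t) (- (- + m + - + m)) (1ℤ - (t + t))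
        (sym (-[-x-x]≡x+x (+ m))) (solve (t ∷ [])) farther
    ... | inj₂ (closer , _) =
      ⊥-elim (¬PosLin-0-1 (PosLin-≡ (+ m - + m) (- t - - (t - 1ℤ)) 0ℤ -1ℤ
                             (+-inverseʳ (+ m)) (solve (t ∷ [])) closer))

    upper-B⇒nearest : ∀ m t → PosLin a (+ m) (- t) → PosLin a (- (+ m + + m)) (1ℤ - (- t + - t)) →
                      Nearest a m t
    upper-B⇒nearest m t lower upper t' t'≢t with <-cmp t t'
    ... | tri< t<t' _ _ =
      inj₂ ( error-decreasing m t t' t<t'
           , PosLin-≡ (- (+ m + + m)) ((1ℤ - (- t + - t)) + (t' - (1ℤ + t))) (- + m - + m) (- - t - - t')
               (sym (-x-x≡-[x+x] (+ m))) (solve (t ∷ t' ∷ []))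
               (PosLin-+α (- (+ m + + m)) (1ℤ - (- t + - t)) (t' - (1ℤ + t)) upper
                 (i≤j⇒0≤j-i (i<j⇒suc[i]≤j t<t'))))
    ... | tri≈ _ t≡t' _ = ⊥-elim (t'≢t (sym t≡t'))
    ... | tri> _ _ t'<t =
      inj₁ ( error-decreasing m t' t t'<t
           , PosLin-≡ (+ m + + m) ((- t + - t) + (t - t')) (+ m + + m) (- t' + - t) refl (solve (t ∷ t' ∷ []))
               (PosLin-+α (+ m + + m) (- t + - t) (t - t') (PosLin-double (+ m) (- t) lower)
                 (<⇒≤ (i<j⇒0<j-i t'<t))))

    upper-A⇒nearest : ∀ m t → PosLin a (- + m) t → PosLin a (- (- + m + - + m)) (1ℤ - (t + t)) →
                      Nearest a m t
    upper-A⇒nearest m t lower upper t' t'≢t with <-cmp t t'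
    ... | tri< t<t' _ _ =
      inj₂ ( error-decreasing m t t' t<t'
           , PosLin-≡ (- + m - + m) ((t + t) + (t' - t)) (- + m - + m) (- - t - - t') refl (solve (t ∷ t' ∷ []))
               (PosLin-+α (- + m - + m) (t + t) (t' - t) (PosLin-double (- + m) t lower)
                 (<⇒≤ (i<j⇒0<j-i t<t'))))
    ... | tri≈ _ t≡t' _ = ⊥-elim (t'≢t (sym t≡t'))
    ... | tri> _ _ t'<t =
      inj₁ ( error-decreasing m t' t t'<t
           , PosLin-≡ (- (- + m + - + m)) ((1ℤ - (t + t)) + (t - (1ℤ + t'))) (+ m + + m) (- t' + - t)
               (-[-x-x]≡x+x (+ m)) (solve (t ∷ t' ∷ []))
               (PosLin-+α (- (- + m + - + m)) (1ℤ - (t + t)) (t - (1ℤ + t')) upper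
                 (i≤j⇒0≤j-i (i<j⇒suc[i]≤j t'<t))))

    InB⇔window : ∀ m → InB a m ⇔ (1 ℕ.≤ m × ∃[ t ] InWindow a (+ m) (- t))
    InB⇔window m = mk⇔ (λ (1≤m , t , near , lower) → 1≤m , t , lower , nearest⇒upper-B m t near)
                       (λ (1≤m , t , lower , upper) → 1≤m , t , upper-B⇒nearest m t lower upper , lower)

    InA⇔window : ∀ m → InA a m ⇔ (1 ℕ.≤ m × ∃[ t ] InWindow a (- + m) t)
    InA⇔window m = mk⇔ (λ (1≤m , t , near , lower) → 1≤m , t , lower , nearest⇒upper-A m t near)
                       (λ (1≤m , t , lower , upper) → 1≤m , t , upper-A⇒nearest m t lower upper , lower)

    previous-positive : ∀ k → 1 ℕ.≤ P a (suc k)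
    previous-positive zero = s≤s z≤n
    previous-positive (suc k) =
      ℕ.≤-trans (previous-positive k)
        (ℕ.≤-trans (ℕ.m≤n*m (P a (suc k)) (a k) {{ℕ.>-nonZero (valid k)}}) (ℕ.m≤m+n _ _))

    p<p-next : ∀ n → p a n ℕ.< p a (suc n)
    p<p-next n = ℕ.<-≤-trans (ℕ.m<m+n (p a n) (previous-positive n))
                   (ℕ.+-monoˡ-≤ (P a (suc n)) (ℕ.m≤n*m (p a n) (a (suc n)) {{ℕ.>-nonZero (valid (suc n))}}))

    previous<p⊎p≡1 : ∀ n → P a (suc n) ℕ.< p a n ⊎ p a n ≡ 1
    previous<p⊎p≡1 (suc n) = inj₁ (p<p-next n)
    previous<p⊎p≡1 zero with a 0 | valid 0
    ... | suc zero    | _ = inj₂ refl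
    ... | suc (suc _) | _ = inj₁ (s≤s (s≤s z≤n))

  determinant : CF → ℕ → ℤ
  determinant a k = + P a (suc k) * + Q a k - + P a k * + Q a (suc k)

  determinant-step : ∀ a k → determinant a (suc k) ≡ - determinant a k
  determinant-step a k = begin
    + P a (2 ℕ.+ k) * Q₁ - P₁ * + Q a (2 ℕ.+ k)
      ≡⟨ cong₂ (λ u v → u * Q₁ - P₁ * v) (pos-*-+ (a k) (P a (suc k)) (P a k))
                                         (pos-*-+ (a k) (Q a (suc k)) (Q a k)) ⟩
    (A * P₁ + P₀) * Q₁ - P₁ * (A * Q₁ + Q₀)
      ≡⟨ expand A P₁ P₀ Q₁ Q₀ ⟩
    - (P₁ * Q₀ - P₀ * Q₁) ∎
    where
    open ≡-Reasoning
    A = + a k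
    P₁ = + P a (suc k)
    P₀ = + P a k
    Q₁ = + Q a (suc k)
    Q₀ = + Q a k
    expand : ∀ A P₁ P₀ Q₁ Q₀ → (A * P₁ + P₀) * Q₁ - P₁ * (A * Q₁ + Q₀) ≡ - (P₁ * Q₀ - P₀ * Q₁)
    expand = solve-∀

  determinant-unit : ∀ a k → determinant a k ≡ 1ℤ ⊎ determinant a k ≡ -1ℤ
  determinant-unit a zero = inj₁ refl
  determinant-unit a (suc k) with determinant-unit a k
  ... | inj₁ det≡1  = inj₂ (trans (determinant-step a k) (cong -_ det≡1))
  ... | inj₂ det≡-1 = inj₁ (trans (determinant-step a k) (cong -_ det≡-1))

  even-or-odd : ∀ n → (∃[ h ] n ≡ h ℕ.+ h) ⊎ (∃[ h ] n ≡ h ℕ.+ h ℕ.+ 1)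
  even-or-odd zero = inj₁ (0 , refl)
  even-or-odd (suc n) with even-or-odd n
  ... | inj₁ (h , n≡h+h)   = inj₂ (h , trans (cong suc n≡h+h) (ℕ.+-comm 1 (h ℕ.+ h)))
  ... | inj₂ (h , n≡h+h+1) =
    inj₁ (suc h , trans (cong suc n≡h+h+1) (cong suc (trans (ℕ.+-comm (h ℕ.+ h) 1) (sym (ℕ.+-suc h h)))))

  Even⇒half : ∀ {n} → Even n → ∃[ h ] n ≡ h ℕ.+ h
  Even⇒half (divides h n≡h*2) = h , trans n≡h*2 (trans (ℕ.*-comm h 2) (cong (h ℕ.+_) (ℕ.+-identityʳ h)))

  half⇒Even : ∀ {n} h → n ≡ h ℕ.+ h → Even n
  half⇒Even h n≡h+h = divides h (trans n≡h+h (sym (trans (ℕ.*-comm h 2) (cong (h ℕ.+_) (ℕ.+-identityʳ h)))))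

  Odd⇒half : ∀ {n} → Odd n → ∃[ h ] n ≡ h ℕ.+ h ℕ.+ 1
  Odd⇒half {n} odd with even-or-odd n
  ... | inj₁ (h , n≡h+h) = ⊥-elim (odd (half⇒Even h n≡h+h))
  ... | inj₂ half = half

  quotient-bound : ∀ k b r m → k ℕ.* m ℕ.≤ b ℕ.* m ℕ.+ r → r ℕ.< m → k ℕ.≤ b
  quotient-bound k b r m km≤bm+r r<m = ℕ.≮⇒≥ λ b<k → ℕ.<⇒≱ (begin-strict
    b ℕ.* m ℕ.+ r  <⟨ ℕ.+-monoʳ-< (b ℕ.* m) r<m ⟩
    b ℕ.* m ℕ.+ m  ≡⟨ ℕ.+-comm (b ℕ.* m) m ⟩
    suc b ℕ.* m    ≤⟨ ℕ.*-monoˡ-≤ m b<k ⟩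
    k ℕ.* m        ∎) km≤bm+r
    where open ℕ.≤-Reasoning

  SameSignSum : CF → ℕ → Set
  SameSignSum a n = ∃[ y₁ ] ∃[ y₂ ] (1 ℕ.≤ y₁ × 1 ℕ.≤ y₂ × y₁ ≢ y₂ × y₁ ℕ.+ y₂ ≡ n
                     × ((InA a y₁ × InA a y₂) ⊎ (InB a y₁ × InB a y₂)))

  WideGap : ℕ → ℕ → Set
  WideGap p₀ p₁ = 3 ℕ.* p₀ ℕ.≤ p₁ ⊎ (Even p₁ × 2 ℕ.* p₀ ℕ.≤ p₁)

  coordinates-upper : ∀ x y P Q →
                      - (x + x) * Q + (1ℤ - (y + y)) * P ≡ P - ((x * Q + y * P) + (x * Q + y * P))
  coordinates-upper = solve-∀

  coordinates-height : ∀ x y P₀ P₁ Q₀ Q₁ →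
                       (x * Q₀ + y * P₀) * P₁ - (x * Q₁ + y * P₁) * P₀ ≡ (P₁ * Q₀ - P₀ * Q₁) * x
  coordinates-height = solve-∀

  module Level (a : CF) (valid : ValidCF a) (n : ℕ) where

    P₀ P₁ Q₀ Q₁ D : ℤ
    P₀ = + p a n
    P₁ = + p a (suc n)
    Q₀ = + q a n
    Q₁ = + q a (suc n)
    D = P₁ * Q₀ - P₀ * Q₁

    ζ : CF
    ζ = tail a (2 ℕ.+ n)

    ζ-valid : ValidCF ζ
    ζ-valid = tail-valid valid (2 ℕ.+ n)

    open Windows (PosLin-half-plane ζ-valid)

    coordinates : ∀ x y → PosLin a x y ⇔ PosLin ζ (x * Q₀ + y * P₀) (x * Q₁ + y * P₁)
    coordinates = PosLin-tail valid (2 ℕ.+ n)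

    InWindow⇔Window : ∀ x y → InWindow a x y ⇔ Window P₀ P₁ (x * Q₀ + y * P₀) (x * Q₁ + y * P₁)
    InWindow⇔Window x y = mk⇔
      (λ (lower , upper) → window (Equivalence.to (coordinates x y) lower)
                                  (subst₂ (PosLin ζ) upper₀ upper₁ (Equivalence.to (coordinates x' y') upper)))
      (λ (window lower upper) → Equivalence.from (coordinates x y) lower
                              , Equivalence.from (coordinates x' y')
                                  (subst₂ (PosLin ζ) (sym upper₀) (sym upper₁) upper))
      where
      x' = - (x + x)
      y' = 1ℤ - (y + y)
      upper₀ = coordinates-upper x y P₀ Q₀
      upper₁ = coordinates-upper x y P₁ Q₁

    D-unit : D ≡ 1ℤ ⊎ D ≡ -1ℤ
    D-unit = determinant-unit a (2 ℕ.+ n)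

    D²≡1 : D * D ≡ 1ℤ
    D²≡1 with D-unit
    ... | inj₁ D≡1  = cong₂ _*_ D≡1 D≡1
    ... | inj₂ D≡-1 = cong₂ _*_ D≡-1 D≡-1

    coprime : Coprime P₀ P₁
    coprime = D * Q₀ , D * Q₁ , trans (regroup D P₀ P₁ Q₀ Q₁) D²≡1
      where
      regroup : ∀ D P₀ P₁ Q₀ Q₁ → D * Q₀ * P₁ - D * Q₁ * P₀ ≡ D * (P₁ * Q₀ - P₀ * Q₁)
      regroup = solve-∀

    0<P₀ : 0ℤ < P₀
    0<P₀ = +<+ (previous-positive valid (suc n))

    P₀<P₁ : P₀ < P₁
    P₀<P₁ = +<+ (p<p-next valid n)

    InWindow⇒height : ∀ x y → InWindow a x y → WindowHeight P₀ P₁ (D * x)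
    InWindow⇒height x y w =
      _ , _ , Equivalence.to (InWindow⇔Window x y) w , trans (coordinates-height x y P₀ P₁ Q₀ Q₁) refl

    height⇒InWindow : ∀ x → WindowHeight P₀ P₁ (D * x) → ∃[ y ] InWindow a x y
    height⇒InWindow x (X , Y , w , height) =
      let y = D * (Q₀ * Y - Q₁ * X)
          recover₀ , recover₁ = unimodular-inverse x X Y refl D²≡1 height
      in y , Equivalence.from (InWindow⇔Window x y) (subst₂ (Window P₀ P₁) (sym recover₀) (sym recover₁) w)

    2p≡P₀+P₀ : + (2 ℕ.* p a n) ≡ P₀ + P₀
    2p≡P₀+P₀ = cong (λ k → + (p a n ℕ.+ k)) (ℕ.+-identityʳ (p a n))

    InB⇒height : ∀ m → InB a m → WindowHeight P₀ P₁ (D * + m)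
    InB⇒height m inB = let _ , t , w = Equivalence.to (InB⇔window valid m) inB in InWindow⇒height (+ m) (- t) w

    InA⇒height : ∀ m → InA a m → WindowHeight P₀ P₁ (- D * + m)
    InA⇒height m inA =
      let _ , t , w = Equivalence.to (InA⇔window valid m) inA
      in subst (WindowHeight P₀ P₁) (trans (sym (neg-distribʳ-* D (+ m))) (neg-distribˡ-* D (+ m)))
           (InWindow⇒height (- + m) t w)

    height⇒InB : ∀ m → 1 ℕ.≤ m → D ≡ 1ℤ → WindowHeight P₀ P₁ (1ℤ * + m) → InB a m
    height⇒InB m 1≤m D≡1 h =
      let t , w = height⇒InWindow (+ m) (subst (λ d → WindowHeight P₀ P₁ (d * + m)) (sym D≡1) h)
      in Equivalence.from (InB⇔window valid m) (1≤m , - t , subst (InWindow a (+ m)) (sym (neg-involutive t)) w)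

    height⇒InA : ∀ m → 1 ℕ.≤ m → D ≡ -1ℤ → WindowHeight P₀ P₁ (1ℤ * + m) → InA a m
    height⇒InA m 1≤m D≡-1 h =
      let t , w = height⇒InWindow (- + m) (subst (WindowHeight P₀ P₁) sign-flip h)
      in Equivalence.from (InA⇔window valid m) (1≤m , t , w)
      where
      open ≡-Reasoning
      sign-flip : 1ℤ * + m ≡ D * - + m
      sign-flip = begin
        1ℤ * + m      ≡⟨ *-identityˡ (+ m) ⟩
        + m           ≡⟨ neg-involutive (+ m) ⟨
        - - + m       ≡⟨ -1*i≡-i (- + m) ⟨
        -1ℤ * - + m   ≡⟨ cong (_* - + m) D≡-1 ⟨
        D * - + m     ∎

    heights⇒WindowPair : ∀ σ {y₁ y₂} → 1 ℕ.≤ y₁ → 1 ℕ.≤ y₂ → y₁ ≢ y₂ → y₁ ℕ.+ y₂ ≡ 2 ℕ.* p a n →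
                         WindowHeight P₀ P₁ (σ * + y₁) → WindowHeight P₀ P₁ (σ * + y₂) → WindowPair P₀ P₁ σ
    heights⇒WindowPair σ {y₁} {y₂} 1≤y₁ 1≤y₂ y₁≢y₂ Σy h₁ h₂ =
      + y₁ , + y₂ , +<+ 1≤y₁ , +<+ 1≤y₂ , (λ eq → y₁≢y₂ (+-injective eq))
           , trans (cong +_ Σy) 2p≡P₀+P₀ , h₁ , h₂

    SameSignSum⇒WindowPair : SameSignSum a (2 ℕ.* p a n) → WindowPair P₀ P₁ D ⊎ WindowPair P₀ P₁ (- D)
    SameSignSum⇒WindowPair (y₁ , y₂ , 1≤y₁ , 1≤y₂ , y₁≢y₂ , Σy , inj₁ (A₁ , A₂)) =
      inj₂ (heights⇒WindowPair (- D) 1≤y₁ 1≤y₂ y₁≢y₂ Σy (InA⇒height y₁ A₁) (InA⇒height y₂ A₂))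
    SameSignSum⇒WindowPair (y₁ , y₂ , 1≤y₁ , 1≤y₂ , y₁≢y₂ , Σy , inj₂ (B₁ , B₂)) =
      inj₁ (heights⇒WindowPair D 1≤y₁ 1≤y₂ y₁≢y₂ Σy (InB⇒height y₁ B₁) (InB⇒height y₂ B₂))

    positive-natural : ∀ {M} → 0ℤ < M → ∃[ y ] (1 ℕ.≤ y × M ≡ + y)
    positive-natural {+ suc y} _ = suc y , s≤s z≤n , refl
    positive-natural {+ zero} (+<+ ())

    WindowPair⇒SameSignSum : WindowPair P₀ P₁ 1ℤ → SameSignSum a (2 ℕ.* p a n)
    WindowPair⇒SameSignSum (M₁ , M₂ , 0<M₁ , 0<M₂ , M₁≢M₂ , ΣM , h₁ , h₂) =
      let y₁ , 1≤y₁ , M₁≡y₁ = positive-natural 0<M₁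
          y₂ , 1≤y₂ , M₂≡y₂ = positive-natural 0<M₂
          h₁' = subst (λ M → WindowHeight P₀ P₁ (1ℤ * M)) M₁≡y₁ h₁
          h₂' = subst (λ M → WindowHeight P₀ P₁ (1ℤ * M)) M₂≡y₂ h₂
      in y₁ , y₂ , 1≤y₁ , 1≤y₂
       , (λ y₁≡y₂ → M₁≢M₂ (trans M₁≡y₁ (trans (cong +_ y₁≡y₂) (sym M₂≡y₂))))
       , +-injective (trans (cong₂ _+_ (sym M₁≡y₁) (sym M₂≡y₂)) (trans ΣM (sym 2p≡P₀+P₀)))
       , (case D-unit of λ where
            (inj₁ D≡1)  → inj₂ (height⇒InB y₁ 1≤y₁ D≡1 h₁' , height⇒InB y₂ 1≤y₂ D≡1 h₂')
            (inj₂ D≡-1) → inj₁ (height⇒InA y₁ 1≤y₁ D≡-1 h₁' , height⇒InA y₂ 1≤y₂ D≡-1 h₂'))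

    open Obstruction 0<P₀ P₀<P₁ coprime

    WideGap⇒Gap : WideGap (p a n) (p a (suc n)) → Gap P₀ P₁
    WideGap⇒Gap (inj₁ 3p₀≤p₁) = inj₁ (subst (_≤ P₁) (pos-* 3 (p a n)) (+≤+ 3p₀≤p₁))
    WideGap⇒Gap (inj₂ (even , 2p₀≤p₁)) =
      let k , p₁≡k+k = Even⇒half even
      in inj₂ ((+ k , cong +_ p₁≡k+k) , subst (_≤ P₁) (pos-* 2 (p a n)) (+≤+ 2p₀≤p₁))

    ¬SameSignSum : Odd (p a n) → WideGap (p a n) (p a (suc n)) → ¬ SameSignSum a (2 ℕ.* p a n)
    ¬SameSignSum odd gap pair = signed-pair-impossible (SameSignSum⇒WindowPair pair) D-unit
      where
      positive : ¬ WindowPair P₀ P₁ 1ℤ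
      positive = let h , p₀≡ = Odd⇒half odd in positive-pair-impossible (+ h) (cong +_ p₀≡) (WideGap⇒Gap gap)
      signed-pair-impossible : WindowPair P₀ P₁ D ⊎ WindowPair P₀ P₁ (- D) → D ≡ 1ℤ ⊎ D ≡ -1ℤ → ⊥
      signed-pair-impossible (inj₁ pair) (inj₁ D≡1)  = positive (subst (WindowPair P₀ P₁) D≡1 pair)
      signed-pair-impossible (inj₁ pair) (inj₂ D≡-1) =
        negative-pair-impossible (subst (WindowPair P₀ P₁) D≡-1 pair)
      signed-pair-impossible (inj₂ pair) (inj₁ D≡1)  =
        negative-pair-impossible (subst (WindowPair P₀ P₁) (cong -_ D≡1) pair)
      signed-pair-impossible (inj₂ pair) (inj₂ D≡-1) = positive (subst (WindowPair P₀ P₁) (cong -_ D≡-1) pair)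

    transport-pair : ∀ {p₀ p₁} → p a n ≡ p₀ → p a (suc n) ≡ p₁ → WindowPair (+ p₀) (+ p₁) 1ℤ →
                     SameSignSum a (2 ℕ.* p a n)
    transport-pair refl refl pair = WindowPair⇒SameSignSum pair

    even⇒SameSignSum : Even (p a n) → SameSignSum a (2 ℕ.* p a n)
    even⇒SameSignSum even = by-parity (Even⇒half even) (2 ∣? p a (suc n))
      where
      by-parity : ∃[ h ] p a n ≡ h ℕ.+ h → Dec (Even (p a (suc n))) → SameSignSum a (2 ℕ.* p a n)
      by-parity (h , p₀≡h+h) (yes even₁) =
        let k , p₁≡k+k = Even⇒half even₁
        in ⊥-elim (¬Coprime-evens (+ h) (+ k) (subst₂ Coprime (cong +_ p₀≡h+h) (cong +_ p₁≡k+k) coprime))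
      by-parity (zero , p₀≡0) (no _) = ⊥-elim (<-irrefl refl (subst (0ℤ <_) (cong +_ p₀≡0) 0<P₀))
      by-parity (suc h , p₀≡h+h) (no odd₁) =
        let k , p₁≡k+k+1 = Odd⇒half odd₁
        in transport-pair p₀≡h+h p₁≡k+k+1
             (even-pair (+ suc h) (+ k) (+<+ (s≤s z≤n)) (subst₂ _<_ (cong +_ p₀≡h+h) (cong +_ p₁≡k+k+1) P₀<P₁))

    WideGap⊎SameSignSum : Odd (p a n) → WideGap (p a n) (p a (suc n)) ⊎ SameSignSum a (2 ℕ.* p a n)
    WideGap⊎SameSignSum odd = by-cases (Odd⇒half odd) (3 ℕ.* p a n ℕ.≤? p a (suc n)) (2 ∣? p a (suc n))
                                       (2 ℕ.* p a n ℕ.≤? p a (suc n))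
      where
      by-cases : ∃[ h ] p a n ≡ h ℕ.+ h ℕ.+ 1 → Dec (3 ℕ.* p a n ℕ.≤ p a (suc n)) → Dec (Even (p a (suc n))) →
                 Dec (2 ℕ.* p a n ℕ.≤ p a (suc n)) → WideGap (p a n) (p a (suc n)) ⊎ SameSignSum a (2 ℕ.* p a n)
      by-cases _ (yes 3p₀≤p₁) _ _ = inj₁ (inj₁ 3p₀≤p₁)
      by-cases _ (no _) (yes even₁) (yes 2p₀≤p₁) = inj₁ (inj₂ (even₁ , 2p₀≤p₁))
      by-cases (h , p₀≡) (no 3p₀≰p₁) (no odd₁) _ =
        let k , p₁≡ = Odd⇒half odd₁
        in inj₂ (transport-pair p₀≡ p₁≡
             (odd-odd-pair (+ h) (+ k) (subst₂ _<_ (cong +_ p₀≡) (cong +_ p₁≡) P₀<P₁)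
                (subst₂ _<_ (cong +_ p₁≡) (trans (pos-* 3 (p a n)) (cong (λ m → + 3 * + m) p₀≡))
                  (+<+ (ℕ.≰⇒> 3p₀≰p₁)))))
      by-cases (h , p₀≡) (no _) (yes even₁) (no 2p₀≰p₁) =
        let k , p₁≡ = Even⇒half even₁
        in inj₂ (transport-pair p₀≡ p₁≡
             (odd-even-pair (+ h) (+ k) (subst₂ _<_ (cong +_ p₀≡) (cong +_ p₁≡) P₀<P₁)
                (subst₂ _<_ (cong +_ p₁≡) (trans (pos-* 2 (p a n)) (cong (λ m → + 2 * + m) p₀≡))
                  (+<+ (ℕ.≰⇒> 2p₀≰p₁)))))

    1≤2p : 1 ℕ.≤ 2 ℕ.* p a n
    1≤2p = ℕ.≤-trans (previous-positive valid (suc n)) (ℕ.m≤m+n (p a n) _)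

    InS⇔Odd×WideGap : InS a (2 ℕ.* p a n) ⇔ (Odd (p a n) × WideGap (p a n) (p a (suc n)))
    InS⇔Odd×WideGap = mk⇔
      (λ (_ , no-sum) → let odd = λ even → no-sum (even⇒SameSignSum even)
                        in odd , [ id , ⊥-elim ∘ no-sum ]′ (WideGap⊎SameSignSum odd))
      (λ (odd , gap) → 1≤2p , ¬SameSignSum odd gap)

    Condition : Set
    Condition = (Odd (p a (suc n)) × 3 ℕ.≤ a (suc n)) ⊎ (Even (p a (suc n)) × 2 ℕ.≤ a (suc n)) ⊎ p a n ≡ 1

    multiple≤p-next : ∀ {k} → k ℕ.≤ a (suc n) → k ℕ.* p a n ℕ.≤ p a (suc n)
    multiple≤p-next k≤a = ℕ.≤-trans (ℕ.*-monoˡ-≤ (p a n) k≤a) (ℕ.m≤m+n _ _)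

    Condition⇒WideGap : Condition → WideGap (p a n) (p a (suc n))
    Condition⇒WideGap (inj₁ (_ , 3≤a)) = inj₁ (multiple≤p-next 3≤a)
    Condition⇒WideGap (inj₂ (inj₁ (even , 2≤a))) = inj₂ (even , multiple≤p-next 2≤a)
    Condition⇒WideGap (inj₂ (inj₂ p₀≡1)) = by-parity (2 ∣? p a (suc n))
      where
      1<p₁ : 1 ℕ.< p a (suc n)
      1<p₁ = subst (ℕ._< p a (suc n)) p₀≡1 (p<p-next valid n)
      3≤odd : ∃[ k ] p a (suc n) ≡ k ℕ.+ k ℕ.+ 1 → 3 ℕ.≤ p a (suc n)
      3≤odd (zero , p₁≡1) = ⊥-elim (ℕ.<-irrefl (sym p₁≡1) 1<p₁)
      3≤odd (suc k , p₁≡) = subst (3 ℕ.≤_) (sym p₁≡) (ℕ.+-monoˡ-≤ 1 (ℕ.+-mono-≤ (s≤s z≤n) (s≤s (z≤n {k}))))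
      by-parity : Dec (Even (p a (suc n))) → WideGap (p a n) (p a (suc n))
      by-parity (yes even) = inj₂ (even , subst (λ m → 2 ℕ.* m ℕ.≤ p a (suc n)) (sym p₀≡1) 1<p₁)
      by-parity (no odd) = inj₁ (subst (λ m → 3 ℕ.* m ℕ.≤ p a (suc n)) (sym p₀≡1) (3≤odd (Odd⇒half odd)))

    WideGap⇒Condition : WideGap (p a n) (p a (suc n)) → Condition
    WideGap⇒Condition gap = by-cases (previous<p⊎p≡1 valid n) gap (2 ∣? p a (suc n))
      where
      by-cases : P a (suc n) ℕ.< p a n ⊎ p a n ≡ 1 → WideGap (p a n) (p a (suc n)) → Dec (Even (p a (suc n))) →
                 Condition
      by-cases (inj₂ p₀≡1) _ _ = inj₂ (inj₂ p₀≡1)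
      by-cases (inj₁ r<p₀) (inj₁ 3p₀≤p₁) (no odd₁) =
        inj₁ (odd₁ , quotient-bound 3 (a (suc n)) _ _ 3p₀≤p₁ r<p₀)
      by-cases (inj₁ r<p₀) (inj₁ 3p₀≤p₁) (yes even₁) =
        inj₂ (inj₁ (even₁ , ℕ.≤-trans (ℕ.n≤1+n 2) (quotient-bound 3 (a (suc n)) _ _ 3p₀≤p₁ r<p₀)))
      by-cases (inj₁ r<p₀) (inj₂ (even₁ , 2p₀≤p₁)) _ =
        inj₂ (inj₁ (even₁ , quotient-bound 2 (a (suc n)) _ _ 2p₀≤p₁ r<p₀))

open ContinuedFractions using (module Level)
open import Data.Nat using (_*_; _≤_)

mainTheorem4 : (a : CF) → ValidCF a → (n : ℕ) →
    InS a (2 * p a n) ⇔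
      (Odd (p a n) ×
        ((Odd (p a (suc n)) × 3 ≤ a (suc n))
         ⊎ (Even (p a (suc n)) × 2 ≤ a (suc n))
         ⊎ p a n ≡ 1))
mainTheorem4 a valid n = mk⇔
  (λ inS → let odd , gap = Equivalence.to InS⇔Odd×WideGap inS in odd , WideGap⇒Condition gap)
  (λ (odd , condition) → Equivalence.from InS⇔Odd×WideGap (odd , Condition⇒WideGap condition))
  where open Level a valid n
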